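{- For all positive integers $n,k$ with $n\ge 2k$, the Schrijver graph $S(n,k)$ contains $K_{n-2k+2}$ as an odd-minor; consequently the Kneser graph $K(n,k)$ also contains $K_{n-2k+2}$ as an odd-minor.
   Context: For positive integers $n\ge 2k$, the Kneser graph $K(n,k)$ has as vertices the $k$-element subsets of $[n]=\{1,\dots,n\}$, two being adjacent iff they are disjoint. A subset of $[n]$ is cyclically stable if it contains no two elements that are consecutive in the cyclic order $1,2,\dots,n,1$ (so in particular not both $1$ and $n$). The Schrijver graph $S(n,k)$ is the subgraph of $K(n,k)$ induced by the cyclically stable $k$-subsets of $[n]$. A graph $G$ contains $H$ as an odd-minor if a graph isomorphic to $H$ can be obtained from some subgraph $G'\subseteq G$ by choosing an edge-cut of $G'$ (the set of edges between $S$ and $V(G')\setminus S$ for some $S\subseteq V(G')$) and contracting all edges of this cut simultaneously. -}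

module Defs where

open import Data.Nat using (ℕ; suc; _≤_; _+_; _*_; _∸_)
open import Data.Bool using (Bool; T)
open import Data.Fin using (Fin; toℕ)
open import Data.Fin.Subset using (Subset; _∈_; _∩_; Empty; ∣_∣)
open import Data.Product using (Σ; ∃; _×_; _,_)
open import Data.Sum using (_⊎_)
open import Data.Empty using (⊥)
open import Relation.Nullary using (¬_)
open import Relation.Binary.PropositionalEquality using (_≡_; _≢_)
open import Relation.Binary.Construct.Closure.ReflexiveTransitive using (Star)
open import Function.Bundles using (_⇔_)

record Graph : Set₁ where
  field
    V   : Set
    Adj : V → V → Set
open Graph public

-- Consecutive elements in the cyclic order 1,2,...,n,1 (elements of [n]
-- are represented by Fin n, i.e. 0,...,n-1).
Consecutive : (n : ℕ) → Fin n → Fin n → Set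
Consecutive n i j = (suc (toℕ i) ≡ toℕ j) ⊎ ((suc (toℕ i) ≡ n) × (toℕ j ≡ 0))

CycStable : (n : ℕ) → Subset n → Set
CycStable n s = ∀ i j → Consecutive n i j → i ∈ s → j ∈ s → ⊥

Kneser : ℕ → ℕ → Graph
Kneser n k = record
  { V   = Σ (Subset n) (λ s → ∣ s ∣ ≡ k)
  ; Adj = λ { (s , _) (t , _) → Empty (s ∩ t) } }

Schrijver : ℕ → ℕ → Graph
Schrijver n k = record
  { V   = Σ (Subset n) (λ s → (∣ s ∣ ≡ k) × CycStable n s)
  ; Adj = λ { (s , _) (t , _) → Empty (s ∩ t) } }

-- G contains the complete graph K_t as an odd-minor:
-- a subgraph G' (vertex set U, edge set E' ⊆ E(G) with ends in U),
-- a set S ⊆ U defining the edge-cut of G' (edges of E' with exactly one end in S),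
-- and the graph obtained by contracting all cut edges is isomorphic to K_t.
-- The vertices of the contracted graph are the connected components of the
-- spanning subgraph (U, cut edges); these are labelled bijectively by Fin t via φ
-- (φ u ≡ φ v iff u and v are joined by a path of cut edges; φ surjective), and
-- any two distinct components are joined by an edge of G'.
record OddMinorK (G : Graph) (t : ℕ) : Set where
  field
    U      : V G → Bool
    E'     : V G → V G → Bool
    E'-sym : ∀ u v → T (E' u v) → T (E' v u)
    E'-adj : ∀ u v → T (E' u v) → Adj G u v
    E'-U   : ∀ u v → T (E' u v) → T (U u) × T (U v)
    S      : V G → Bool
  CutEdge : V G → V G → Set
  CutEdge u v = T (E' u v) × (S u ≢ S v)
  field
    φ      : (v : V G) → T (U v) → Fin t
    comp   : ∀ u v (pu : T (U u)) (pv : T (U v)) → (φ u pu ≡ φ v pv) ⇔ Star CutEdge u v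
    surj   : ∀ (i : Fin t) → Σ (V G) (λ v → Σ (T (U v)) (λ pv → φ v pv ≡ i))
    adj    : ∀ (i j : Fin t) → i ≢ j →
             Σ (V G) (λ u → Σ (V G) (λ v → Σ (T (U u)) (λ pu → Σ (T (U v)) (λ pv →
               (φ u pu ≡ i) × (φ v pv ≡ j) × T (E' u v)))))

-- Odd K_t-minor models are built in the disjointness graph on all subsets of [n], with
-- every branch vertex a cyclically stable k-set; restricting such a model to the vertices
-- of S(n,k), or of K(n,k), gives the two odd minors.
--
-- For k = 1 the n singletons form a clique, and colouring everything alike contracts
-- nothing, so S(n,1) contains K_n. A model for k-subsets of [n] lifts to one for
-- (k+1)-subsets of [n+2] with the same t. Writing positions from 0, each branch vertex a is
-- replaced by its copies {0} ∪ (a+2), {1} ∪ (a+2) and, when neither 0 nor n-1 lies in a,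
-- also {2} ∪ (a+3), which is disjoint from both. The copies that are cyclically stable
-- form a path, which is contracted because the middle copy gets the opposite colour.
-- For an edge a–b of the old model, disjointness and cyclic stability of a and b ensure
-- that the {0}-copy of a and the {1}-copy of b exist, or the other way round, so the edge
-- can be put between those copies with its colours unchanged. After k-1 lifts,
-- S(n-2k+2,1) = K_{n-2k+2} becomes a model in S(n,k).

module Submission where

open import Data.Bool using (Bool; true; false; not; _∧_; _∨_; T; if_then_else_)
import Data.Bool as Bool
open import Data.Bool.Properties using (∧-zeroʳ; ∧-identityʳ; T-irrelevant; T-∨; not-¬)
open import Data.Fin using (Fin; zero; suc; toℕ)
open import Data.Fin.Properties using (any?)
open import Data.Fin.Subset using (Subset; _∈_; _∉_; _∩_; ⊥; Empty; ∣_∣; ⁅_⁆)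
open import Data.Fin.Subset.Properties
  using (∉⊥; drop-∷-Empty; Empty-unique; ∩-comm; nonempty?; x∈⁅x⁆; x∈⁅y⁆⇒x≡y; x∈p∩q⁻; ∣⁅x⁆∣≡1)
open import Data.Nat using (ℕ; zero; suc; _+_; _*_; _∸_; _≤_)
import Data.Nat as ℕ
open import Data.Nat.Properties
  using (suc-injective; ≡-irrelevant; 1+n≢n; +-comm; *-comm; m+[n∸m]≡n)
open import Data.Product using (∃; ∃₂; Σ; _×_; _,_; proj₁; proj₂; map₂)
open import Data.Sum using (_⊎_; inj₁; inj₂)
import Data.Sum as Sum
open import Data.Unit using (⊤; tt)
open import Data.Vec using ([]; _∷_; head; last; _∷ʳ_; initLast; here; there)
open import Data.Vec.Properties using (≡-dec; last-∷ʳ)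
open import Data.Vec.Relation.Unary.Linked using (Linked; []; [-]; _∷_; linked?)
open import Function using (_∘_; id)
open import Function.Bundles using (_⇔_; mk⇔; Equivalence)
open import Relation.Binary.Core using (Rel)
open import Relation.Binary.Construct.Closure.ReflexiveTransitive
  using (Star; ε; _◅_; _◅◅_; gmap; reverse; kleisliStar)
open import Relation.Binary.PropositionalEquality
open import Relation.Nullary using (¬_; Dec; yes; _×-dec_; contradiction)
open import Relation.Nullary.Decidable using (⌊_⌋; toWitness; fromWitness; ¬?)

open import Defs

private
  variable
    n : ℕ

Apart : Bool → Bool → Set
Apart x y = x ∧ y ≡ false

Sparse : Subset n → Set
Sparse = Linked Apart

-- CycStable of Defs, by recursion on the vector instead of on positions.
CyclicallySparse : Subset n → Set
CyclicallySparse {zero}  _ = ⊤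
CyclicallySparse {suc n} s = Sparse s × Apart (head s) (last s)

apart? : ∀ x y → Dec (Apart x y)
apart? x y = x ∧ y Bool.≟ false

cyclicallySparse? : (s : Subset n) → Dec (CyclicallySparse s)
cyclicallySparse? {zero}  _ = yes tt
cyclicallySparse? {suc n} s = linked? apart? s ×-dec apart? (head s) (last s)

infix 4 _≟ₛ_
_≟ₛ_ : (s t : Subset n) → Dec (s ≡ t)
_≟ₛ_ = ≡-dec Bool._≟_

Sparse-∷ʳ⁻ : ∀ {x} (s : Subset n) → Sparse (s ∷ʳ x) → Sparse s
Sparse-∷ʳ⁻ []          _        = []
Sparse-∷ʳ⁻ (y ∷ [])    _        = [-]
Sparse-∷ʳ⁻ (y ∷ z ∷ s) (p ∷ ps) = p ∷ Sparse-∷ʳ⁻ (z ∷ s) ps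

Sparse⇒∩-shift≡⊥ : ∀ x (s : Subset n) → Sparse (x ∷ s) → (x ∷ s) ∩ (s ∷ʳ false) ≡ ⊥
Sparse⇒∩-shift≡⊥ x []      [-]      = cong (_∷ []) (∧-zeroʳ x)
Sparse⇒∩-shift≡⊥ x (y ∷ s) (p ∷ ps) = cong₂ _∷_ p (Sparse⇒∩-shift≡⊥ y s ps)

Sparse-⊥ : Sparse (⊥ {n})
Sparse-⊥ {zero}        = []
Sparse-⊥ {suc zero}    = [-]
Sparse-⊥ {suc (suc n)} = refl ∷ Sparse-⊥

last-⊥ : last (⊥ {suc n}) ≡ false
last-⊥ {zero}  = refl
last-⊥ {suc n} = last-⊥ {n}

Sparse-⁅⁆ : ∀ (i : Fin n) → Sparse ⁅ i ⁆
Sparse-⁅⁆ {suc zero}    zero    = [-]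
Sparse-⁅⁆ {suc (suc n)} zero    = refl ∷ Sparse-⊥
Sparse-⁅⁆ {suc (suc n)} (suc i) = refl ∷ Sparse-⁅⁆ i

CyclicallySparse-⁅⁆ : ∀ (i : Fin (2 + n)) → CyclicallySparse ⁅ i ⁆
CyclicallySparse-⁅⁆ {n} zero = Sparse-⁅⁆ zero , last-⊥ {suc n}
CyclicallySparse-⁅⁆ (suc i)  = Sparse-⁅⁆ (suc i) , refl

∣s∷ʳfalse∣≡∣s∣ : ∀ (s : Subset n) → ∣ s ∷ʳ false ∣ ≡ ∣ s ∣
∣s∷ʳfalse∣≡∣s∣ []          = refl
∣s∷ʳfalse∣≡∣s∣ (true ∷ s)  = cong suc (∣s∷ʳfalse∣≡∣s∣ s)
∣s∷ʳfalse∣≡∣s∣ (false ∷ s) = ∣s∷ʳfalse∣≡∣s∣ s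

Sparse⇒∉-next : ∀ {s : Subset n} → Sparse s → ∀ i j → suc (toℕ i) ≡ toℕ j → i ∈ s → j ∉ s
Sparse⇒∉-next (() ∷ _) zero    (suc zero)    _  here       (there here)
Sparse⇒∉-next (_ ∷ ps) (suc i) (suc j)       eq (there i∈) (there j∈) =
  Sparse⇒∉-next ps i j (suc-injective eq) i∈ j∈
Sparse⇒∉-next (_ ∷ _)  zero    (suc (suc _)) ()
Sparse⇒∉-next [-]      zero    zero          ()

head-∈ : ∀ {x} {s : Subset n} {j} → toℕ j ≡ 0 → j ∈ x ∷ s → x ≡ true
head-∈ {j = zero} _ here = refl

last-∈ : ∀ {s : Subset (suc n)} {i} → suc (toℕ i) ≡ suc n → i ∈ s → last s ≡ true
last-∈ {s = _ ∷ []}    {zero}  _  here       = refl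
last-∈ {s = _ ∷ _ ∷ _} {suc i} eq (there i∈) = last-∈ (suc-injective eq) i∈

CyclicallySparse⇒CycStable : ∀ (s : Subset n) → CyclicallySparse s → CycStable n s
CyclicallySparse⇒CycStable (x ∷ s) (sparse , _) i j (inj₁ eq) i∈ j∈ =
  Sparse⇒∉-next sparse i j eq i∈ j∈
CyclicallySparse⇒CycStable (x ∷ s) (_ , ends) i j (inj₂ (i-last , j-first)) i∈ j∈
  with refl ← head-∈ j-first j∈ = contradiction (trans (sym ends) (last-∈ i-last i∈)) λ ()

Empty-⊥ : Empty (⊥ {n})
Empty-⊥ (_ , x∈⊥) = ∉⊥ x∈⊥

Empty-∷ : ∀ {p : Subset n} → Empty p → Empty (false ∷ p)
Empty-∷ e (suc x , there x∈p) = e (x , x∈p)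

Empty-∩-sym : ∀ (s t : Subset n) → Empty (s ∩ t) → Empty (t ∩ s)
Empty-∩-sym s t = subst Empty (∩-comm s t)

Empty-∩-head : ∀ (s t : Subset (suc n)) → Empty (s ∩ t) → Apart (head s) (head t)
Empty-∩-head (x ∷ s) (y ∷ t) e = cong head (Empty-unique e)

Empty-∩-last : ∀ (s t : Subset (suc n)) → Empty (s ∩ t) → Apart (last s) (last t)
Empty-∩-last (x ∷ [])     (y ∷ [])     e = Empty-∩-head (x ∷ []) (y ∷ []) e
Empty-∩-last (x ∷ x′ ∷ s) (y ∷ y′ ∷ t) e = Empty-∩-last (x′ ∷ s) (y′ ∷ t) (drop-∷-Empty e)

Empty-⁅⁆∩⁅⁆ : ∀ {i j : Fin n} → i ≢ j → Empty (⁅ i ⁆ ∩ ⁅ j ⁆)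
Empty-⁅⁆∩⁅⁆ {i = i} {j} i≢j (x , x∈) =
  let x∈⁅i⁆ , x∈⁅j⁆ = x∈p∩q⁻ ⁅ i ⁆ ⁅ j ⁆ x∈
  in i≢j (trans (sym (x∈⁅y⁆⇒x≡y i x∈⁅i⁆)) (x∈⁅y⁆⇒x≡y j x∈⁅j⁆))

⁅⁆-injective : ∀ {i j : Fin n} → ⁅ i ⁆ ≡ ⁅ j ⁆ → i ≡ j
⁅⁆-injective {i = i} {j} eq = x∈⁅y⁆⇒x≡y j (subst (i ∈_) eq (x∈⁅x⁆ i))

singleton? : (s : Subset n) → Dec (∃ λ i → s ≡ ⁅ i ⁆)
singleton? s = any? λ i → s ≟ₛ ⁅ i ⁆

orientation : ∀ {ha la hb lb} → Apart ha la → Apart hb lb → Apart ha hb → Apart la lb →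
              (la ≡ false × hb ≡ false) ⊎ (lb ≡ false × ha ≡ false)
orientation {la = false} {hb = false} _ _ _ _ = inj₁ (refl , refl)
orientation {ha = false} {lb = false} _ _ _ _ = inj₂ (refl , refl)
orientation {true}  {true}  ()
orientation {false} {true}  {false} {true} _ _ _ ()
orientation {false} {true}  {true}  {true} _ () _ _
orientation {false} {false} {true}  {true} _ () _ _

cross-orientation : ∀ {a b : Subset (suc n)} → CyclicallySparse a → CyclicallySparse b →
                    Empty (a ∩ b) →
                    (last a ≡ false × head b ≡ false) ⊎ (last b ≡ false × head a ≡ false)
cross-orientation {a = a} {b} (_ , ends-a) (_ , ends-b) a∩b =
  orientation ends-a ends-b (Empty-∩-head a b a∩b) (Empty-∩-last a b a∩b)

T-∧³ : ∀ {x y z} → T (x ∧ y ∧ z) ⇔ (T x × T y × T z)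
T-∧³ {true}  {true}  = mk⇔ (λ z → tt , tt , z) (proj₂ ∘ proj₂)
T-∧³ {true}  {false} = mk⇔ (λ ()) (λ ())
T-∧³ {false}         = mk⇔ (λ ()) (λ ())

Disjointness : ℕ → Graph
Disjointness n = record { V = Subset n ; Adj = λ s t → Empty (s ∩ t) }

Induced : (G : Graph) → (V G → Set) → Graph
Induced G P = record { V = Σ (V G) P ; Adj = λ u v → Adj G (proj₁ u) (proj₁ v) }

module _ {G : Graph} {t : ℕ} (M : OddMinorK G t) where
  open OddMinorK M

  φ-cong : ∀ {u v} → u ≡ v → (pu : T (U u)) (pv : T (U v)) → φ u pu ≡ φ v pv
  φ-cong {u} refl pu pv = Equivalence.from (comp u u pu pv) ε

  CutEdge-sym : ∀ {u v} → CutEdge u v → CutEdge v u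
  CutEdge-sym (e , S≢) = E'-sym _ _ e , S≢ ∘ sym

  restrict : (P : V G → Set) → (∀ {v} (p q : P v) → p ≡ q) → (∀ v → T (U v) → P v) →
             OddMinorK (Induced G P) t
  restrict P P-irrelevant U⇒P = record
    { U      = U ∘ proj₁
    ; E'     = λ u v → E' (proj₁ u) (proj₁ v)
    ; E'-sym = λ u v → E'-sym (proj₁ u) (proj₁ v)
    ; E'-adj = λ u v → E'-adj (proj₁ u) (proj₁ v)
    ; E'-U   = λ u v → E'-U (proj₁ u) (proj₁ v)
    ; S      = S ∘ proj₁
    ; φ      = φ ∘ proj₁
    ; comp   = λ u v pu pv → mk⇔
        (λ eq → restrict-path (Equivalence.to (comp _ _ pu pv) eq) u v refl refl)
        (λ path → Equivalence.from (comp _ _ pu pv) (gmap proj₁ id path))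
    ; surj   = λ i → let v , pv , eq = surj i in (v , U⇒P v pv) , pv , eq
    ; adj    = λ i j i≢j → let u , v , pu , pv , eqᵢ , eqⱼ , e = adj i j i≢j in
        (u , U⇒P u pu) , (v , U⇒P v pv) , pu , pv , eqᵢ , eqⱼ , e
    }
    where
    CutEdgeᴾ : Rel (Σ (V G) P) _
    CutEdgeᴾ u v = CutEdge (proj₁ u) (proj₁ v)

    restrict-path : ∀ {u v} → Star CutEdge u v →
                    ∀ u′ v′ → proj₁ u′ ≡ u → proj₁ v′ ≡ v → Star CutEdgeᴾ u′ v′
    restrict-path ε (u , p) (.u , q) refl refl rewrite P-irrelevant p q = ε
    restrict-path (_◅_ {j = w} e path) u′ v′ refl eq =
      e ◅ restrict-path path (w , U⇒P w (proj₂ (E'-U _ w (proj₁ e)))) v′ refl eq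

record SchrijverModel (n k t : ℕ) : Set where
  field
    model  : OddMinorK (Disjointness n) t
    stable : ∀ s → T (OddMinorK.U model s) → ∣ s ∣ ≡ k × CyclicallySparse s
  open OddMinorK model public

module _ {n k t : ℕ} (M : SchrijverModel n k t) where
  open SchrijverModel M

  -- The CycStable components need no argument: they are functions into the
  -- definitionally proof-irrelevant ⊥.
  schrijver : OddMinorK (Schrijver n k) t
  schrijver = restrict model _ (λ (p , _) (q , _) → cong (_, _) (≡-irrelevant p q))
                λ s → map₂ (CyclicallySparse⇒CycStable s) ∘ stable s

  kneser : OddMinorK (Kneser n k) t
  kneser = restrict model _ ≡-irrelevant λ s → proj₁ ∘ stable s

singletons : ∀ m → SchrijverModel (2 + m) 1 (2 + m)
singletons m = record
  { model  = record
    { U      = U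
    ; E'     = E'
    ; E'-sym = λ u v e → let pu , pv , d = edge-view e in edge pv pu (Empty-∩-sym u v d)
    ; E'-adj = λ u v e → proj₂ (proj₂ (edge-view e))
    ; E'-U   = λ u v e → let pu , pv , _ = edge-view e in pu , pv
    ; S      = λ _ → false
    ; φ      = φ
    ; comp   = λ u v pu pv → mk⇔ (λ eq → subst (Star _ u) (φ-injective pu pv eq) ε)
                                 (λ path → same-label (no-cut path) pu pv)
    ; surj   = λ i → ⁅ i ⁆ , U-⁅⁆ i , φ-⁅⁆ i
    ; adj    = λ i j i≢j → ⁅ i ⁆ , ⁅ j ⁆ , U-⁅⁆ i , U-⁅⁆ j , φ-⁅⁆ i , φ-⁅⁆ j ,
                 edge (U-⁅⁆ i) (U-⁅⁆ j) (Empty-⁅⁆∩⁅⁆ i≢j)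
    }
  ; stable = λ s p → let i , s≡⁅i⁆ = toWitness p in
      subst (λ s → ∣ s ∣ ≡ 1 × CyclicallySparse s) (sym s≡⁅i⁆) (∣⁅x⁆∣≡1 i , CyclicallySparse-⁅⁆ i)
  }
  where
  U : Subset (2 + m) → Bool
  U s = ⌊ singleton? s ⌋

  E' : Subset (2 + m) → Subset (2 + m) → Bool
  E' u v = U u ∧ U v ∧ ⌊ ¬? (nonempty? (u ∩ v)) ⌋

  edge : ∀ {u v} → T (U u) → T (U v) → Empty (u ∩ v) → T (E' u v)
  edge {u} {v} pu pv d = Equivalence.from (T-∧³ {U u} {U v}) (pu , pv , fromWitness d)

  edge-view : ∀ {u v} → T (E' u v) → T (U u) × T (U v) × Empty (u ∩ v)
  edge-view {u} {v} e =
    let pu , pv , d = Equivalence.to (T-∧³ {U u} {U v}) e in pu , pv , toWitness d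

  φ : (s : Subset (2 + m)) → T (U s) → Fin (2 + m)
  φ s p = proj₁ (toWitness p)

  φ-injective : ∀ {u v} (pu : T (U u)) (pv : T (U v)) → φ u pu ≡ φ v pv → u ≡ v
  φ-injective pu pv eq =
    trans (proj₂ (toWitness pu)) (trans (cong ⁅_⁆ eq) (sym (proj₂ (toWitness pv))))

  same-label : ∀ {u v} → u ≡ v → (pu : T (U u)) (pv : T (U v)) → φ u pu ≡ φ v pv
  same-label refl pu pv = cong (φ _) (T-irrelevant pu pv)

  no-cut : ∀ {u v} → Star (λ u v → T (E' u v) × false ≢ false) u v → u ≡ v
  no-cut ε               = refl
  no-cut ((_ , f≢f) ◅ _) = contradiction refl f≢f

  U-⁅⁆ : ∀ i → T (U ⁅ i ⁆)
  U-⁅⁆ i = fromWitness (i , refl)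

  φ-⁅⁆ : ∀ i → φ ⁅ i ⁆ (U-⁅⁆ i) ≡ i
  φ-⁅⁆ i = sym (⁅⁆-injective (proj₂ (toWitness (U-⁅⁆ i))))

module Lift {N k t : ℕ} (M : SchrijverModel (suc N) k t) where
  open SchrijverModel M

  pattern left  a  = true  ∷ false ∷ a
  pattern right a  = false ∷ true  ∷ a
  pattern middle r = false ∷ false ∷ true ∷ r

  sparse : ∀ {a} → T (U a) → CyclicallySparse a
  sparse {a} = proj₂ ∘ stable a

  size : ∀ {a} → T (U a) → ∣ a ∣ ≡ k
  size {a} = proj₁ ∘ stable a

  -- Junk on the shapes `true ∷ true ∷ _` and `false ∷ false ∷ false ∷ _`, which U⁺ rejects.
  base : Subset (3 + N) → Subset (suc N)
  base (_ ∷ true ∷ a)          = a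
  base (left a)                = a
  base (false ∷ false ∷ _ ∷ r) = r ∷ʳ false

  -- Opaque so that X can be inferred from T (U⁺ X); branch and branch-view are its interface.
  opaque
    U⁺ : Subset (3 + N) → Bool
    U⁺ X = ⌊ cyclicallySparse? X ⌋ ∧ ⌊ ∣ X ∣ ℕ.≟ suc k ⌋ ∧ U (base X)

    branch : ∀ {X} → CyclicallySparse X → ∣ X ∣ ≡ suc k → T (U (base X)) → T (U⁺ X)
    branch {X} cs sz p = Equivalence.from (T-∧³ {⌊ cyclicallySparse? X ⌋} {⌊ ∣ X ∣ ℕ.≟ suc k ⌋})
                           (fromWitness cs , fromWitness sz , p)

    branch-view : ∀ X → T (U⁺ X) → CyclicallySparse X × ∣ X ∣ ≡ suc k × T (U (base X))
    branch-view X p =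
      let cs , sz , pa = Equivalence.to (T-∧³ {⌊ cyclicallySparse? X ⌋} {⌊ ∣ X ∣ ℕ.≟ suc k ⌋}) p
      in toWitness cs , toWitness sz , pa

  left-branch : ∀ {a} → T (U a) → last a ≡ false → T (U⁺ (left a))
  left-branch pa la = branch ((refl ∷ refl ∷ proj₁ (sparse pa)) , la) (cong suc (size pa)) pa

  right-branch : ∀ {a} → T (U a) → head a ≡ false → T (U⁺ (right a))
  right-branch pa ha = branch ((refl ∷ ha ∷ proj₁ (sparse pa)) , refl) (cong suc (size pa)) pa

  middle-branch : ∀ {r} → T (U (r ∷ʳ false)) → head (r ∷ʳ false) ≡ false → T (U⁺ (middle r))
  middle-branch {r} pa ha =
    branch ((refl ∷ refl ∷ Sparse-∷ʳ⁻ (true ∷ r) (ha ∷ proj₁ (sparse pa))) , refl)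
           (cong suc (trans (sym (∣s∷ʳfalse∣≡∣s∣ r)) (size pa))) pa

  ¬U⁺-000 : ∀ {r} → ¬ T (U⁺ (false ∷ false ∷ false ∷ r))
  ¬U⁺-000 {r} p = let _ , sz , pa = branch-view (false ∷ false ∷ false ∷ r) p in
    1+n≢n (trans (sym sz) (trans (sym (∣s∷ʳfalse∣≡∣s∣ r)) (size pa)))

  -- left a is not cyclically stable when the last position lies in a.
  lift : Subset (suc N) → Subset (3 + N)
  lift a = if last a then right a else left a

  base-lift : ∀ a → base (lift a) ≡ a
  base-lift a with last a
  ... | true  = refl
  ... | false = refl

  lift-branch : ∀ {a} → T (U a) → T (U⁺ (lift a))
  lift-branch {a} pa with last a in la | proj₂ (sparse pa)
  ... | true  | ends = right-branch pa (trans (sym (∧-identityʳ (head a))) ends)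
  ... | false | _    = left-branch pa la

  arc : Subset (3 + N) → Subset (3 + N) → Bool
  arc (left a)   (right b) = E' a b
  arc (middle r) (left a)  = ⌊ a ≟ₛ r ∷ʳ false ⌋
  arc (middle r) (right a) = ⌊ a ≟ₛ r ∷ʳ false ⌋
  arc _          _         = false

  data Arc : Subset (3 + N) → Subset (3 + N) → Set where
    cross  : ∀ {a b} → T (E' a b) → Arc (left a) (right b)
    spokeˡ : ∀ {r} → Arc (middle r) (left (r ∷ʳ false))
    spokeʳ : ∀ {r} → Arc (middle r) (right (r ∷ʳ false))

  arc-view : ∀ X Y → T (arc X Y) → Arc X Y
  arc-view (left a)   (right b) e = cross e
  arc-view (middle r) (left a)  e with refl ← toWitness e = spokeˡ
  arc-view (middle r) (right a) e with refl ← toWitness e = spokeʳ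

  arc-sound : ∀ {X Y} → Arc X Y → T (arc X Y)
  arc-sound (cross e) = e
  arc-sound spokeˡ    = fromWitness refl
  arc-sound spokeʳ    = fromWitness refl

  Link : Subset (3 + N) → Subset (3 + N) → Set
  Link X Y = Arc X Y ⊎ Arc Y X

  opaque
    E⁺ : Subset (3 + N) → Subset (3 + N) → Bool
    E⁺ X Y = U⁺ X ∧ U⁺ Y ∧ (arc X Y ∨ arc Y X)

    edge : ∀ {X Y} → T (U⁺ X) → T (U⁺ Y) → Link X Y → T (E⁺ X Y)
    edge {X} {Y} pX pY l = Equivalence.from (T-∧³ {U⁺ X} {U⁺ Y})
      (pX , pY , Equivalence.from T-∨ (Sum.map arc-sound arc-sound l))

    edge-view : ∀ X Y → T (E⁺ X Y) → T (U⁺ X) × T (U⁺ Y) × Link X Y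
    edge-view X Y e = let pX , pY , l = Equivalence.to (T-∧³ {U⁺ X} {U⁺ Y}) e in
      pX , pY , Sum.map (arc-view X Y) (arc-view Y X) (Equivalence.to T-∨ l)

  -- Flipping the colour of the middle copies makes every spoke a cut edge, while
  -- cross edges keep the colours of the edge of the old model they come from.
  S⁺ : Subset (3 + N) → Bool
  S⁺ X@(false ∷ false ∷ _) = not (S (base X))
  S⁺ X                     = S (base X)

  Cut⁺ : Subset (3 + N) → Subset (3 + N) → Set
  Cut⁺ X Y = T (E⁺ X Y) × S⁺ X ≢ S⁺ Y

  Cut⁺-sym : ∀ {X Y} → Cut⁺ X Y → Cut⁺ Y X
  Cut⁺-sym {X} {Y} (e , S≢) =
    let pX , pY , l = edge-view X Y e in edge pY pX (Sum.swap l) , S≢ ∘ sym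

  middle-disjoint : ∀ {r} → T (U⁺ (middle r)) → Empty ((true ∷ r) ∩ (r ∷ʳ false))
  middle-disjoint {r} p with ((_ ∷ _ ∷ sp) , _) , _ ← branch-view (middle r) p =
    subst Empty (sym (Sparse⇒∩-shift≡⊥ true r sp)) Empty-⊥

  arc-disjoint : ∀ {X Y} → Arc X Y → T (U⁺ X) → Empty (X ∩ Y)
  arc-disjoint (cross e) _ = Empty-∷ (Empty-∷ (E'-adj _ _ e))
  arc-disjoint spokeˡ    p = Empty-∷ (Empty-∷ (middle-disjoint p))
  arc-disjoint spokeʳ    p = Empty-∷ (Empty-∷ (middle-disjoint p))

  arc-base : ∀ {X Y} → Arc X Y → S⁺ X ≢ S⁺ Y → Star CutEdge (base X) (base Y)
  arc-base (cross e) S≢ = (e , S≢) ◅ ε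
  arc-base spokeˡ    _  = ε
  arc-base spokeʳ    _  = ε

  cut-base : ∀ {X Y} → Cut⁺ X Y → Star CutEdge (base X) (base Y)
  cut-base {X} {Y} (e , S≢) with edge-view X Y e
  ... | _ , _ , inj₁ a = arc-base a S≢
  ... | _ , _ , inj₂ a = reverse (CutEdge-sym model) (arc-base a (S≢ ∘ sym))

  spoke-cut : ∀ {r Y} → Arc (middle r) Y → T (U⁺ (middle r)) → T (U⁺ Y) → Cut⁺ (middle r) Y
  spoke-cut a pM pY = edge pM pY (inj₁ a) , S≢ a
    where
    S≢ : ∀ {r Y} → Arc (middle r) Y → S⁺ (middle r) ≢ S⁺ Y
    S≢ spokeˡ = not-¬ refl ∘ sym
    S≢ spokeʳ = not-¬ refl ∘ sym

  right⇝left : ∀ a → last a ≡ false → T (U⁺ (right a)) → Star Cut⁺ (right a) (left a)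
  right⇝left a la pR with initLast a
  -- last is defined through initLast, so la has become x ≡ false here.
  ... | r , x , refl with refl ← la
                     with (_ ∷ ha ∷ _ , _) , _ , pa ← branch-view (right (r ∷ʳ false)) pR =
    Cut⁺-sym (spoke-cut spokeʳ pM pR) ◅ spoke-cut spokeˡ pM (left-branch pa (last-∷ʳ false r)) ◅ ε
    where pM = middle-branch pa ha

  to-lift : ∀ X → T (U⁺ X) → Star Cut⁺ X (lift (base X))
  to-lift (left a) p with (_ , la) , _ ← branch-view (left a) p rewrite la = ε
  to-lift (right a) p with last a in la
  ... | true  = ε
  ... | false = right⇝left a la p
  to-lift (middle r) p with _ , _ , pa ← branch-view (middle r) p rewrite last-∷ʳ false r =
    spoke-cut spokeˡ p (left-branch pa (last-∷ʳ false r)) ◅ ε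
  to-lift (true ∷ true ∷ a) p with (() ∷ _ , _) , _ ← branch-view (true ∷ true ∷ a) p
  to-lift (false ∷ false ∷ false ∷ r) p = contradiction p ¬U⁺-000

  via : ∀ {X Y} → Cut⁺ X Y → Star Cut⁺ (lift (base X)) (lift (base Y))
  via {X} {Y} c with pX , pY , _ ← edge-view X Y (proj₁ c) =
    reverse Cut⁺-sym (to-lift X pX) ◅◅ c ◅ to-lift Y pY

  cross-edge : ∀ {a b} → T (E' a b) → T (E⁺ (left a) (right b)) ⊎ T (E⁺ (right a) (left b))
  cross-edge {a} {b} e
    with pa , pb ← E'-U a b e | cross-orientation (sparse pa) (sparse pb) (E'-adj a b e)
  ... | inj₁ (la , hb) = inj₁ (edge (left-branch pa la) (right-branch pb hb) (inj₁ (cross e)))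
  ... | inj₂ (lb , ha) =
        inj₂ (edge (right-branch pa ha) (left-branch pb lb) (inj₂ (cross (E'-sym a b e))))

  cut-lift : ∀ {a b} → CutEdge a b → Star Cut⁺ (lift a) (lift b)
  cut-lift (e , S≢) with cross-edge e
  ... | inj₁ e⁺ = via (e⁺ , S≢)
  ... | inj₂ e⁺ = via (e⁺ , S≢)

  φ⁺ : ∀ X → T (U⁺ X) → Fin t
  φ⁺ X p = φ (base X) (proj₂ (proj₂ (branch-view X p)))

  LabelledEdge : Fin t → Fin t → Set
  LabelledEdge i j =
    ∃₂ λ X Y → ∃₂ λ (pX : T (U⁺ X)) (pY : T (U⁺ Y)) → φ⁺ X pX ≡ i × φ⁺ Y pY ≡ j × T (E⁺ X Y)

  labelled-edge : ∀ {a b X Y} (pa : T (U a)) (pb : T (U b)) → base X ≡ a → base Y ≡ b →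
                  T (E⁺ X Y) → LabelledEdge (φ a pa) (φ b pb)
  labelled-edge {X = X} {Y} pa pb bX bY e⁺ = let pX , pY , _ = edge-view X Y e⁺ in
    X , Y , pX , pY , φ-cong model bX _ pa , φ-cong model bY _ pb , e⁺

  adj⁺ : ∀ i j → i ≢ j → LabelledEdge i j
  adj⁺ i j i≢j with a , b , pa , pb , refl , refl , e ← adj i j i≢j =
    Sum.[ labelled-edge pa pb refl refl , labelled-edge pa pb refl refl ] (cross-edge e)

  lifted : SchrijverModel (3 + N) (suc k) t
  lifted = record
    { model = record
      { U      = U⁺
      ; E'     = E⁺
      ; E'-sym = λ X Y e → let pX , pY , l = edge-view X Y e in edge pY pX (Sum.swap l)
      ; E'-adj = λ X Y e → let pX , pY , l = edge-view X Y e in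
          Sum.[ (λ a → arc-disjoint a pX) , (λ a → Empty-∩-sym Y X (arc-disjoint a pY)) ] l
      ; E'-U   = λ X Y e → let pX , pY , _ = edge-view X Y e in pX , pY
      ; S      = S⁺
      ; φ      = φ⁺
      ; comp   = λ X Y pX pY → mk⇔
          (λ eq → to-lift X pX ◅◅ kleisliStar lift cut-lift (Equivalence.to (comp _ _ _ _) eq)
                    ◅◅ reverse Cut⁺-sym (to-lift Y pY))
          (λ path → Equivalence.from (comp _ _ _ _) (kleisliStar base cut-base path))
      ; surj   = λ i → let a , pa , eq = surj i in
          lift a , lift-branch pa , trans (φ-cong model (base-lift a) _ pa) eq
      ; adj    = adj⁺
      }
    ; stable = λ X p → let cs , sz , _ = branch-view X p in sz , cs
    }

schrijverModel : ∀ j m → SchrijverModel (suc j * 2 + m) (suc j) (2 + m)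
schrijverModel zero    m = singletons m
schrijverModel (suc j) m = Lift.lifted (schrijverModel j m)

theorem3 : ∀ (n k : ℕ) → 1 ≤ k → 2 * k ≤ n →
    OddMinorK (Schrijver n k) (n ∸ 2 * k + 2) × OddMinorK (Kneser n k) (n ∸ 2 * k + 2)
theorem3 n (suc j) _ 2k≤n = schrijver M , kneser M
  where
  m = n ∸ 2 * suc j
  M : SchrijverModel n (suc j) (m + 2)
  M = subst₂ (λ n t → SchrijverModel n (suc j) t)
        (trans (cong (_+ m) (*-comm (suc j) 2)) (m+[n∸m]≡n 2k≤n)) (+-comm 2 m) (schrijverModel j m)
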